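{- Let $S$ be a finite set of schemas, $c_1$ a coupling map for $S$ over a set $D_1$ and $c_2$ a coupling map for $S$ over a set $D_2$ such that $c_2\preceq c_1$, and let $F$ be a formula function for $S$. If there is a $\Sigma$-structure $\mathcal R_1$ with domain $D_1$ such that $\mathcal R_1\models_{c_1}F$, then there exists a $\Sigma$-structure $\mathcal R_2$ with domain $D_2$ such that $\mathcal R_2\models_{c_2}F$.
   Context: Language signature $\Sigma=(\mathrm{Args},\mathrm{Rels},\mathrm{ar})$: $\mathrm{Args},\mathrm{Rels}$ finite non-empty, $\mathrm{ar}:\mathrm{Rels}\to\mathcal P(\mathrm{Args})\setminus\{\emptyset\}$. A $\Sigma$-structure $\mathcal R=(D,\cdot^{\mathcal R})$: $D$ non-empty, $r^{\mathcal R}$ a set of functions $\mathrm{ar}(r)\to D$. FOL formulas: $\varphi::= r\mid\neg\varphi\mid\varphi\wedge\varphi\mid\varphi\vee\varphi\mid\exists x.\varphi\mid\forall x.\varphi\mid(a,x)\varphi$, semantics over partial assignments $\chi:\mathrm{Args}\cup\mathrm{Var}\rightharpoonup D$: $\mathcal R,\chi\models r$ iff $\chi|_{\mathrm{ar}(r)}\in r^{\mathcal R}$; usual Boolean/quantifier clauses; $\mathcal R,\chi\models(a,x)\varphi$ iff $\mathcal R,\chi[a\mapsto\chi(x)]\models\varphi$. A quantification prefix $\wp$ is a finite word over $\{\exists x,\forall x\}$, each variable at most once, with variables $\mathrm{vars}(\wp)$, existential ones $\exists(\wp)$, universal ones $\forall(\wp)$; $\mathrm{Dep}_\wp(y)$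 for $y\in\exists(\wp)$ is the set of universal variables before $y$. A binding prefix $\flat$ is a finite word over pairs $(a,x)$, each argument at most once, viewed as partial function $\mathrm{Args}\rightharpoonup\mathrm{Var}$ with domain $\mathrm{args}(\flat)$ and range $\mathrm{vars}(\flat)$. A derived relation is a Boolean combination of relations all with the same argument set (its argument set). $\mathrm{Asg}_D(P)$: functions $P\to D$. Skolem map for $\wp$ over $D$: $\theta:\mathrm{Asg}_D(\forall(\wp))\to\mathrm{Asg}_D(\mathrm{vars}(\wp))$, identity on universal variables, and the value at each existential $y$ depends only on the restriction of the input to $\mathrm{Dep}_\wp(y)$. $\mathcal R,\chi\models_\theta\psi$ iff $\mathcal R,\chi'\models\psi$ for all $\chi'$ with domain $\mathrm{dom}(\chi)\cup\mathrm{vars}(\wp)$, $\chi\subseteq\chi'$, $\chi'|_{\mathrm{vars}(\wp)}\in\mathrm{rng}(\theta)$. A schema is $\sigma=(\wp(\sigma),\flat(\sigma))$ with $\mathrm{vars}(\wp(\sigma))=\mathrm{vars}(\flat(\sigma))$; $\mathrm{args}(\sigma)=\mathrm{args}(\flat(\sigma))$; $\mathrm{Sch}(A)$ is the set of schemas with argument set $A$. A coupling map $c$ for $S$ over $D$ assigns to each $\sigma\in S$ a Skolem map $c(\sigma)$ for $\wp(\sigma)$ over $D$. A formula function $F$ for $S$ assigns to each $\sigma\in S$ a derived relation with argument set $\mathrm{args}(\sigma)$; $\mathcal R\models_cF$ iff $\mathcal R,\emptyset\models_{c(\sigma)}\flat(\sigma)F(\sigma)$ for all $\sigma\in S$. Entanglement: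 for $A'\subseteq A\subseteq\mathrm{Args}$ and $S'\subseteq S\cap\mathrm{Sch}(A)$, $\mathrm{Ent}_c(S',A')=\{t:A'\to D\mid\forall\sigma\in S'\,\exists\chi\in\mathrm{rng}(c(\sigma))\,.\,t=(\chi\circ\flat(\sigma))|_{A'}\}$. $c_2\preceq c_1$ iff for all such $A',A,S'$, $\mathrm{Ent}_{c_2}(S',A')\ne\emptyset$ implies $\mathrm{Ent}_{c_1}(S',A')\ne\emptyset$. -}

module Defs where

open import Data.Nat using (ℕ; _≡ᵇ_)
open import Data.Fin using (Fin; _≟_)
open import Data.Fin.Subset using (Subset)
open import Data.Vec using (lookup; tabulate)
open import Data.Bool using (Bool; true; false; T; _∧_; _∨_; if_then_else_)
open import Data.Maybe using (Maybe; just; nothing; is-just)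
open import Data.List using (List; []; _∷_; map; foldr; length)
import Data.List as L
open import Data.List.Relation.Unary.Unique.Propositional using (Unique)
open import Data.Sum using (_⊎_)
open import Data.Product using (Σ; Σ-syntax; _×_; _,_; proj₁; proj₂)
open import Relation.Nullary using (¬_; does)
open import Relation.Binary.PropositionalEquality using (_≡_)

record Signature : Set where
  field
    nArgs nRels   : ℕ
    ar            : Fin nRels → Subset nArgs
    ar-nonempty   : ∀ r → Σ[ a ∈ Fin nArgs ] T (lookup (ar r) a)
    args-nonempty : Fin nArgs
    rels-nonempty : Fin nRels

Var : Set
Var = ℕ

_∈ₛ_ : ∀ {n} → Fin n → Subset n → Set
a ∈ₛ A = T (lookup A a)

_⊆ₛ_ : ∀ {n} → Subset n → Subset n → Set
A ⊆ₛ B = ∀ a → a ∈ₛ A → a ∈ₛ B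

-- Asg_D(P) for a set of variables P given by its characteristic function.
Asg : Set → (Var → Bool) → Set
Asg D P = (x : Var) → T (P x) → D

data Quant : Set where
  ∃q ∀q : Quant

QPrefix : Set
QPrefix = List (Quant × Var)

isAll : Quant → Bool
isAll ∃q = false
isAll ∀q = true

isEx : Quant → Bool
isEx ∃q = true
isEx ∀q = false

varsQ : QPrefix → Var → Bool
varsQ ℘ x = foldr (λ qz b → (proj₂ qz ≡ᵇ x) ∨ b) false ℘

univQ : QPrefix → Var → Bool
univQ ℘ x = foldr (λ qz b → (isAll (proj₁ qz) ∧ (proj₂ qz ≡ᵇ x)) ∨ b) false ℘

existQ : QPrefix → Var → Bool
existQ ℘ x = foldr (λ qz b → (isEx (proj₁ qz) ∧ (proj₂ qz ≡ᵇ x)) ∨ b) false ℘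

depQ : QPrefix → Var → Var → Bool
depQ []              y x = false
depQ ((q , z) ∷ ℘)   y x =
  if z ≡ᵇ y then false else ((isAll q ∧ (z ≡ᵇ x)) ∨ depQ ℘ y x)

QPrefixOK : QPrefix → Set
QPrefixOK ℘ = Unique (map proj₂ ℘)

module _ (Sig : Signature) where
  open Signature Sig

  BPrefix : Set
  BPrefix = List (Fin nArgs × Var)

  BPrefixOK : BPrefix → Set
  BPrefixOK ♭ = Unique (map proj₁ ♭)

  bindLookup : BPrefix → Fin nArgs → Maybe Var
  bindLookup []             a = nothing
  bindLookup ((b , z) ∷ ♭)  a = if does (b ≟ a) then just z else bindLookup ♭ a

  argsB : BPrefix → Subset nArgs
  argsB ♭ = tabulate (λ a → is-just (bindLookup ♭ a))

  varsB : BPrefix → Var → Bool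
  varsB ♭ x = foldr (λ az b → (proj₂ az ≡ᵇ x) ∨ b) false ♭

  record Schema : Set where
    constructor schema
    field
      qp : QPrefix
      bp : BPrefix
  open Schema public

  WFSchema : Schema → Set
  WFSchema σ = QPrefixOK (qp σ) × BPrefixOK (bp σ) × (∀ x → varsQ (qp σ) x ≡ varsB (bp σ) x)

  argsS : Schema → Subset nArgs
  argsS σ = argsB (bp σ)

  -- Σ-structures.  r^R is a set of functions ar(r) → D, given as a
  -- predicate respecting (pointwise) equality of functions.

  ArgFun : Set → Subset nArgs → Set
  ArgFun D A = (a : Fin nArgs) → a ∈ₛ A → D

  record Structure (D : Set) : Set₁ where
    field
      elem : D       -- D non-empty
      interp : (r : Fin nRels) → ArgFun D (ar r) → Set
      interp-resp : ∀ r (f g : ArgFun D (ar r)) →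
                 (∀ a p → f a p ≡ g a p) → interp r f → interp r g
  open Structure public

  data Formula : Set where
    rel  : Fin nRels → Formula
    neg  : Formula → Formula
    and  : Formula → Formula → Formula
    or   : Formula → Formula → Formula
    ex   : Var → Formula → Formula
    all  : Var → Formula → Formula
    bind : Fin nArgs → Var → Formula → Formula

  -- partial assignment χ : Args ∪ Var ⇀ D
  record PAsg (D : Set) : Set where
    constructor pasg
    field
      onArgs : Fin nArgs → Maybe D
      onVars : Var → Maybe D
  open PAsg public

  emptyAsg : ∀ {D} → PAsg D
  emptyAsg = pasg (λ _ → nothing) (λ _ → nothing)

  setVar : ∀ {D} → PAsg D → Var → Maybe D → PAsg D
  setVar χ x v = pasg (onArgs χ) (λ y → if x ≡ᵇ y then v else onVars χ y)

  setArg : ∀ {D} → PAsg D → Fin nArgs → Maybe D → PAsg D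
  setArg χ a v = pasg (λ b → if does (a ≟ b) then v else onArgs χ b) (onVars χ)

  Sat : ∀ {D} → Structure D → PAsg D → Formula → Set
  Sat R χ (rel r)      = Σ[ f ∈ ArgFun _ (ar r) ]
                           ((∀ a p → onArgs χ a ≡ just (f a p)) × interp R r f)
  Sat R χ (neg φ)      = ¬ Sat R χ φ
  Sat R χ (and φ ψ)    = Sat R χ φ × Sat R χ ψ
  Sat R χ (or φ ψ)     = Sat R χ φ ⊎ Sat R χ ψ
  Sat R χ (ex x φ)     = Σ[ d ∈ _ ] Sat R (setVar χ x (just d)) φ
  Sat R χ (all x φ)    = ∀ d → Sat R (setVar χ x (just d)) φ
  Sat R χ (bind a x φ) = Sat R (setArg χ a (onVars χ x)) φ

  applyBP : BPrefix → Formula → Formula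
  applyBP ♭ φ = foldr (λ ax ψ → bind (proj₁ ax) (proj₂ ax) ψ) φ ♭

  data DRel (A : Subset nArgs) : Set where
    atom : (r : Fin nRels) → ar r ≡ A → DRel A
    neg  : DRel A → DRel A
    and  : DRel A → DRel A → DRel A
    or   : DRel A → DRel A → DRel A

  toFormula : ∀ {A} → DRel A → Formula
  toFormula (atom r _) = rel r
  toFormula (neg φ)    = neg (toFormula φ)
  toFormula (and φ ψ)  = and (toFormula φ) (toFormula ψ)
  toFormula (or φ ψ)   = or (toFormula φ) (toFormula ψ)

  record Skolem (D : Set) (℘ : QPrefix) : Set where
    field
      θ : Asg D (univQ ℘) → Asg D (varsQ ℘)
      identity-on-univ : ∀ α x (p : T (univQ ℘ x)) (q : T (varsQ ℘ x)) →
                         θ α x q ≡ α x p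
      dependence : ∀ α β y (q : T (varsQ ℘ y)) → T (existQ ℘ y) →
                   (∀ x (p : T (univQ ℘ x)) → T (depQ ℘ y x) → α x p ≡ β x p) →
                   θ α y q ≡ θ β y q
  open Skolem public

  SatSk : ∀ {D} {℘ : QPrefix} → Structure D → PAsg D → Skolem D ℘ → Formula → Set
  SatSk {D} {℘} R χ sk ψ =
    (χ' : PAsg D) →
    (∀ a → is-just (onArgs χ' a) ≡ is-just (onArgs χ a)) →
    (∀ x → is-just (onVars χ' x) ≡ (is-just (onVars χ x) ∨ varsQ ℘ x)) →
    (∀ a d → onArgs χ a ≡ just d → onArgs χ' a ≡ just d) →
    (∀ x d → onVars χ x ≡ just d → onVars χ' x ≡ just d) →
    (Σ[ α ∈ Asg D (univQ ℘) ] (∀ x (q : T (varsQ ℘ x)) → onVars χ' x ≡ just (θ sk α x q))) →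
    Sat R χ' ψ

  module _ (S : List Schema) where

    sch : Fin (length S) → Schema
    sch i = L.lookup S i

    Coupling : Set → Set
    Coupling D = (i : Fin (length S)) → Skolem D (qp (sch i))

    FormulaFn : Set
    FormulaFn = (i : Fin (length S)) → DRel (argsS (sch i))

    Models : ∀ {D} → Structure D → Coupling D → FormulaFn → Set
    Models R c F = ∀ i → SatSk R emptyAsg (c i) (applyBP (bp (sch i)) (toFormula (F i)))

    -- t ∈ Ent_c(S', A')   (S' a subset of S, given as a predicate on positions)
    InEnt : ∀ {D} → Coupling D → (Fin (length S) → Set) → (A' : Subset nArgs) →
            ArgFun D A' → Set
    InEnt c S' A' t =
      ∀ i → S' i →
      Σ[ α ∈ Asg _ (univQ (qp (sch i))) ]
        (∀ a (p : a ∈ₛ A') x → bindLookup (bp (sch i)) a ≡ just x →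
           (q : T (varsQ (qp (sch i)) x)) → t a p ≡ θ (c i) α x q)

    EntNonEmpty : ∀ {D} → Coupling D → (Fin (length S) → Set) → Subset nArgs → Set
    EntNonEmpty {D} c S' A' = Σ[ t ∈ ArgFun D A' ] InEnt c S' A' t

    _⪯_ : ∀ {D₂ D₁} → Coupling D₂ → Coupling D₁ → Set₁
    c₂ ⪯ c₁ = (A A' : Subset nArgs) → A' ⊆ₛ A →
              (S' : Fin (length S) → Set) → (∀ i → S' i → argsS (sch i) ≡ A) →
              EntNonEmpty c₂ S' A' → EntNonEmpty c₁ S' A'

module Submission where

-- A tuple t₂ over D₂ with argument set A is "realized" by those schemas
-- σ ∈ S with args(σ) = A whose c₂-Skolem map can produce t₂ through ♭(σ).  By
-- c₂ ⪯ c₁ the entanglement of this set of schemas under c₁ is non-empty, so we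
-- may choose a tuple translate(t₂) over D₁ realized by every one of those
-- schemas under c₁.  The structure R₂ interprets r on t₂ as R₁ does on
-- translate(t₂).  For a schema σ and a c₂-assignment, ♭(σ) exposes a tuple t₂
-- realized by σ; hence translate(t₂) is exposed by some c₁-assignment, where
-- R₁ satisfies F(σ).  Since F(σ) is a Boolean combination of atoms over the
-- single argument set args(σ), its truth only depends on the atoms at the
-- exposed tuple, and these agree in R₂ at t₂ and in R₁ at translate(t₂).

open import Defs
open import Data.List using (List; []; _∷_; length; map)
open import Data.List.Relation.Unary.All using (All)
open import Data.List.Relation.Unary.Unique.Propositional using (Unique)
open import Data.Product using (Σ-syntax; _×_; _,_; proj₁; proj₂)

open import Data.Nat using (_≡ᵇ_)
open import Data.Nat.Properties using (≡⇒≡ᵇ)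
open import Data.Fin using (Fin; _≟_)
open import Data.Fin.Subset using (Subset)
open import Data.Vec using (Vec; lookup; tabulate)
open import Data.Vec.Properties using (lookup∘tabulate; tabulate-cong)
open import Data.Bool using (Bool; true; false; T; _∨_)
open import Data.Bool.Properties using (T-irrelevant)
open import Data.Maybe using (Maybe; just; nothing; is-just; fromMaybe)
open import Data.Maybe.Properties using (just-injective)
import Data.List.Relation.Unary.All as All
open import Data.List.Relation.Unary.AllPairs using (_∷_)
open import Data.List.Membership.Propositional.Properties using (∈-lookup)
open import Data.Unit using (tt)
open import Function.Bundles using (_⇔_; mk⇔; Equivalence)
open import Function.Construct.Composition using (_⇔-∘_)
open import Function.Construct.Symmetry using (⇔-sym)
open import Function.Related.TypeIsomorphisms using (¬-cong-⇔)
open import Data.Product.Function.NonDependent.Propositional using (_×-⇔_)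
open import Data.Sum.Function.Propositional using (_⊎-⇔_)
open import Relation.Nullary using (yes; no)
open import Relation.Nullary.Decidable using (dec-true; dec-false)
open import Relation.Binary.PropositionalEquality

whenT : {X : Set} (b : Bool) → (T b → X) → Maybe X
whenT true  h = just (h tt)
whenT false h = nothing

whenT-just : {X : Set} (b : Bool) (h : T b → X) (p : T b) → whenT b h ≡ just (h p)
whenT-just true h tt = refl

whenT-is-just : {X : Set} (b : Bool) (h : T b → X) → is-just (whenT b h) ≡ b
whenT-is-just true  h = refl
whenT-is-just false h = refl

whenT-cong : {X : Set} (b : Bool) {h h' : T b → X} → (∀ p → h p ≡ h' p) → whenT b h ≡ whenT b h'
whenT-cong true  e = cong just (e tt)
whenT-cong false e = refl

T-∨ˡ : ∀ a b → T a → T (a ∨ b)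
T-∨ˡ true b _ = tt

T-∨ʳ : ∀ a b → T b → T (a ∨ b)
T-∨ʳ true  b _ = tt
T-∨ʳ false b p = p

module _ (Sig : Signature) where
  open Signature Sig

  AgreesOn : ∀ {D} → PAsg Sig D → (A : Subset nArgs) → ArgFun Sig D A → Set
  AgreesOn χ A t = ∀ a (p : a ∈ₛ A) → onArgs χ a ≡ just (t a p)

  -- Pointwise equality of tuples (tuples carry membership proofs, so this is
  -- the equality that structures are required to respect).
  EqOn : ∀ {D} (A : Subset nArgs) → ArgFun Sig D A → ArgFun Sig D A → Set
  EqOn A t t' = ∀ a (p : a ∈ₛ A) → t a p ≡ t' a p

  setArg-same : ∀ {D} (χ : PAsg Sig D) a v → onArgs (setArg Sig χ a v) a ≡ v
  setArg-same χ a v rewrite dec-true (a ≟ a) refl = refl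

  setArg-other : ∀ {D} (χ : PAsg Sig D) {a b} v → a ≢ b → onArgs (setArg Sig χ a v) b ≡ onArgs χ b
  setArg-other χ {a} {b} v a≢b rewrite dec-false (a ≟ b) a≢b = refl

  bindAll : ∀ {D} → BPrefix Sig → PAsg Sig D → PAsg Sig D
  bindAll []             χ = χ
  bindAll ((a , x) ∷ ♭) χ = bindAll ♭ (setArg Sig χ a (onVars χ x))

  sat-applyBP : ∀ {D} (R : Structure Sig D) ♭ χ φ →
                Sat Sig R χ (applyBP Sig ♭ φ) ⇔ Sat Sig R (bindAll ♭ χ) φ
  sat-applyBP R []             χ φ = mk⇔ (λ s → s) (λ s → s)
  sat-applyBP R ((a , x) ∷ ♭) χ φ = sat-applyBP R ♭ (setArg Sig χ a (onVars χ x)) φ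

  bindAll-unbound : ∀ {D} ♭ (χ : PAsg Sig D) {a} → All (a ≢_) (map proj₁ ♭) →
                    onArgs (bindAll ♭ χ) a ≡ onArgs χ a
  bindAll-unbound []             χ         _           = refl
  bindAll-unbound ((b , z) ∷ ♭) χ {a} (a≢b All.∷ a∉♭) =
    trans (bindAll-unbound ♭ _ a∉♭) (setArg-other χ _ (λ b≡a → a≢b (sym b≡a)))

  bindAll-bound : ∀ {D} ♭ (χ : PAsg Sig D) {a x} → BPrefixOK Sig ♭ →
                  bindLookup Sig ♭ a ≡ just x → onArgs (bindAll ♭ χ) a ≡ onVars χ x
  bindAll-bound ((b , z) ∷ ♭) χ {a} (b∉♭ ∷ ok) e with b ≟ a
  ... | yes refl = trans (bindAll-unbound ♭ _ b∉♭)
                         (trans (setArg-same χ b _) (cong (onVars χ) (just-injective e)))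
  ... | no  _    = bindAll-bound ♭ _ ok e

  bound-var : ∀ ♭ a → a ∈ₛ argsB Sig ♭ → Σ[ x ∈ Var ] bindLookup Sig ♭ a ≡ just x
  bound-var ♭ a p with bindLookup Sig ♭ a
                     | subst T (lookup∘tabulate (λ b → is-just (bindLookup Sig ♭ b)) a) p
  ... | just x | _ = x , refl

  bound-var-in-vars : ∀ ♭ {a x} → bindLookup Sig ♭ a ≡ just x → T (varsB Sig ♭ x)
  bound-var-in-vars ((b , z) ∷ ♭) {a} {x} e with b ≟ a
  ... | yes _ rewrite just-injective e = T-∨ˡ (x ≡ᵇ x) _ (≡⇒≡ᵇ x x refl)
  ... | no  _ = T-∨ʳ (z ≡ᵇ x) _ (bound-var-in-vars ♭ e)

  θ-cong : ∀ {D ℘} (sk : Skolem Sig D ℘) α {x y} → x ≡ y →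
           (q : T (varsQ ℘ x)) (q' : T (varsQ ℘ y)) → θ sk α x q ≡ θ sk α y q'
  θ-cong sk α refl q q' = cong (θ sk α _) (T-irrelevant q q')

  skolemAsg : ∀ {D ℘} → Skolem Sig D ℘ → Asg D (univQ ℘) → PAsg Sig D
  skolemAsg {℘ = ℘} sk α = pasg (λ _ → nothing) (λ x → whenT (varsQ ℘ x) (θ sk α x))

  VarsFrom : ∀ {D ℘} → PAsg Sig D → Skolem Sig D ℘ → Asg D (univQ ℘) → Set
  VarsFrom {℘ = ℘} χ sk α = ∀ x (q : T (varsQ ℘ x)) → onVars χ x ≡ just (θ sk α x q)

  skolemAsg-vars : ∀ {D ℘} (sk : Skolem Sig D ℘) α → VarsFrom (skolemAsg sk α) sk α
  skolemAsg-vars {℘ = ℘} sk α x = whenT-just (varsQ ℘ x) (θ sk α x)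

  satSk-instance : ∀ {D ℘} (R : Structure Sig D) (sk : Skolem Sig D ℘) ψ →
                   SatSk Sig R (emptyAsg Sig) sk ψ → ∀ α → Sat Sig R (skolemAsg sk α) ψ
  satSk-instance {℘ = ℘} R sk ψ sat α =
    sat (skolemAsg sk α) (λ _ → refl) (λ x → whenT-is-just (varsQ ℘ x) _)
        (λ _ _ ()) (λ _ _ ()) (α , skolemAsg-vars sk α)

  -- The schema σ can produce the tuple t through ♭(σ) under the Skolem map sk;
  -- Ent_c(S', A) consists of the tuples realized by every schema of S'.
  Realizes : ∀ {D} (σ : Schema Sig) → Skolem Sig D (qp σ) → (A : Subset nArgs) → ArgFun Sig D A → Set
  Realizes {D} σ sk A t =
    Σ[ α ∈ Asg D (univQ (qp σ)) ]
      (∀ a (p : a ∈ₛ A) x → bindLookup Sig (bp σ) a ≡ just x →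
         (q : T (varsQ (qp σ) x)) → t a p ≡ θ sk α x q)

  realizes-resp : ∀ {D} σ (sk : Skolem Sig D (qp σ)) {A} {t t' : ArgFun Sig D A} →
                  EqOn A t t' → Realizes σ sk A t → Realizes σ sk A t'
  realizes-resp σ sk t≈t' (α , h) = α , λ a p x e q → trans (sym (t≈t' a p)) (h a p x e q)

  module _ {D} (σ : Schema Sig) (wf : WFSchema Sig σ) (sk : Skolem Sig D (qp σ)) where

    -- Bound variables are quantified, since vars(℘(σ)) = vars(♭(σ)).
    bound-in-vars : ∀ {a x} → bindLookup Sig (bp σ) a ≡ just x → T (varsQ (qp σ) x)
    bound-in-vars {x = x} e = subst T (sym (proj₂ (proj₂ wf) x)) (bound-var-in-vars (bp σ) e)

    boundTuple : Asg D (univQ (qp σ)) → ArgFun Sig D (argsS Sig σ)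
    boundTuple α a p = let (x , e) = bound-var (bp σ) a p in θ sk α x (bound-in-vars e)

    boundTuple-realized : ∀ α → Realizes σ sk (argsS Sig σ) (boundTuple α)
    boundTuple-realized α = α , λ a p x e q →
      θ-cong sk α (just-injective (trans (sym (proj₂ (bound-var (bp σ) a p))) e)) _ q

    bindAll-agrees : ∀ χ α (t : ArgFun Sig D (argsS Sig σ)) → VarsFrom χ sk α →
                     (∀ a p x → bindLookup Sig (bp σ) a ≡ just x → (q : T (varsQ (qp σ) x)) →
                        t a p ≡ θ sk α x q) →
                     AgreesOn (bindAll (bp σ) χ) (argsS Sig σ) t
    bindAll-agrees χ α t χ-from-α α-realizes-t a p =
      let (x , e) = bound-var (bp σ) a p ; q = bound-in-vars e in
      begin
        onArgs (bindAll (bp σ) χ) a  ≡⟨ bindAll-bound (bp σ) χ (proj₁ (proj₂ wf)) e ⟩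
        onVars χ x                   ≡⟨ χ-from-α x q ⟩
        just (θ sk α x q)            ≡⟨ cong just (sym (α-realizes-t a p x e q)) ⟩
        just (t a p)                 ∎
      where open ≡-Reasoning

  sat-rel : ∀ {D} (R : Structure Sig D) r χ (t : ArgFun Sig D (ar r)) →
            AgreesOn χ (ar r) t → Sat Sig R χ (rel r) ⇔ interp R r t
  sat-rel R r χ t χ∼t = mk⇔
    (λ (f , χ∼f , f∈r) → interp-resp R r f t
                           (λ a p → just-injective (trans (sym (χ∼f a p)) (χ∼t a p))) f∈r)
    (λ t∈r → t , χ∼t , t∈r)

  drel-transfer : ∀ {D D'} (R : Structure Sig D) (R' : Structure Sig D') χ χ' {A} (φ : DRel Sig A) →
                  (∀ r → ar r ≡ A → Sat Sig R χ (rel r) ⇔ Sat Sig R' χ' (rel r)) →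
                  Sat Sig R χ (toFormula Sig φ) ⇔ Sat Sig R' χ' (toFormula Sig φ)
  drel-transfer R R' χ χ' (atom r e) atoms = atoms r e
  drel-transfer R R' χ χ' (neg φ)    atoms = ¬-cong-⇔ (drel-transfer R R' χ χ' φ atoms)
  drel-transfer R R' χ χ' (and φ ψ)  atoms =
    drel-transfer R R' χ χ' φ atoms ×-⇔ drel-transfer R R' χ χ' ψ atoms
  drel-transfer R R' χ χ' (or φ ψ)   atoms =
    drel-transfer R R' χ χ' φ atoms ⊎-⇔ drel-transfer R R' χ χ' ψ atoms

  -- Canonical codes of tuples: pointwise equal tuples have equal codes, and a
  -- tuple is recovered from its code (given a default element).
  encode : ∀ {D} (A : Subset nArgs) → ArgFun Sig D A → Vec (Maybe D) nArgs
  encode A t = tabulate (λ a → whenT (lookup A a) (t a))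

  encode-cong : ∀ {D} (A : Subset nArgs) {t t' : ArgFun Sig D A} → EqOn A t t' → encode A t ≡ encode A t'
  encode-cong A t≈t' = tabulate-cong (λ a → whenT-cong (lookup A a) (t≈t' a))

  decode : ∀ {D} → D → (A : Subset nArgs) → Vec (Maybe D) nArgs → ArgFun Sig D A
  decode d A v a _ = fromMaybe d (lookup v a)

  decode-encode : ∀ {D} (d : D) (A : Subset nArgs) (t : ArgFun Sig D A) → EqOn A (decode d A (encode A t)) t
  decode-encode d A t a p =
    cong (fromMaybe d) (trans (lookup∘tabulate _ a) (whenT-just (lookup A a) (t a) p))

  module Transfer (S : List (Schema Sig)) {D₁ D₂ : Set} (d₂ : D₂)
                  (c₁ : Coupling Sig S D₁) (c₂ : Coupling Sig S D₂)
                  (c₂⪯c₁ : _⪯_ Sig S c₂ c₁) where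

    realizers : (A : Subset nArgs) → Vec (Maybe D₂) nArgs → Fin (length S) → Set
    realizers A v i = (argsS Sig (sch Sig S i) ≡ A) × Realizes (sch Sig S i) (c₂ i) A (decode d₂ A v)

    -- The decoded tuple lies in Ent_{c₂}(realizers A v, A), so Ent_{c₁} of the same set is inhabited.
    translation : (A : Subset nArgs) (v : Vec (Maybe D₂) nArgs) → EntNonEmpty Sig S c₁ (realizers A v) A
    translation A v =
      c₂⪯c₁ A A (λ _ p → p) (realizers A v) (λ _ → proj₁) (decode d₂ A v , λ _ → proj₂)

    translate : (A : Subset nArgs) → ArgFun Sig D₂ A → ArgFun Sig D₁ A
    translate A t = proj₁ (translation A (encode A t))

    translate-cong : (A : Subset nArgs) {t t' : ArgFun Sig D₂ A} → EqOn A t t' → translate A t ≡ translate A t'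
    translate-cong A t≈t' = cong (λ v → proj₁ (translation A v)) (encode-cong A t≈t')

    translate-realized : ∀ i {A} (t : ArgFun Sig D₂ A) → argsS Sig (sch Sig S i) ≡ A →
                         Realizes (sch Sig S i) (c₂ i) A t →
                         Realizes (sch Sig S i) (c₁ i) A (translate A t)
    translate-realized i {A} t args≡A realized =
      proj₂ (translation A (encode A t)) i
        (args≡A , realizes-resp (sch Sig S i) (c₂ i) {A} (λ a p → sym (decode-encode d₂ A t a p)) realized)

    translated : Structure Sig D₁ → Structure Sig D₂
    translated R₁ = record
      { elem        = d₂
      ; interp      = λ r t → interp R₁ r (translate (ar r) t)
      ; interp-resp = λ r t t' t≈t' → subst (interp R₁ r) (translate-cong (ar r) t≈t')
      }

    atom-transfer : (R₁ : Structure Sig D₁) (r : Fin nRels) {A : Subset nArgs} → ar r ≡ A →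
                    (t₂ : ArgFun Sig D₂ A) (χ₂ : PAsg Sig D₂) (χ₁ : PAsg Sig D₁) →
                    AgreesOn χ₂ A t₂ → AgreesOn χ₁ A (translate A t₂) →
                    Sat Sig (translated R₁) χ₂ (rel r) ⇔ Sat Sig R₁ χ₁ (rel r)
    atom-transfer R₁ r refl t₂ χ₂ χ₁ χ₂∼t₂ χ₁∼t₁ =
      ⇔-sym (sat-rel R₁ r χ₁ (translate (ar r) t₂) χ₁∼t₁) ⇔-∘ sat-rel (translated R₁) r χ₂ t₂ χ₂∼t₂

    translated-models : All (WFSchema Sig) S → (F : FormulaFn Sig S) (R₁ : Structure Sig D₁) →
                        Models Sig S R₁ c₁ F → Models Sig S (translated R₁) c₂ F
    translated-models wfs F R₁ R₁⊨F i χ₂ _ _ _ _ (α₂ , χ₂-from-α₂) =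
      Equivalence.from (sat-applyBP R₂ ♭ χ₂ φ)
        (Equivalence.from (drel-transfer R₂ R₁ (bindAll ♭ χ₂) (bindAll ♭ χ₁) (F i) atoms) sat₁)
      where
        σ  = sch Sig S i
        ♭  = bp σ
        φ  = toFormula Sig (F i)
        R₂ = translated R₁
        wf = All.lookup wfs (∈-lookup i)

        t₂ : ArgFun Sig D₂ (argsS Sig σ)
        t₂ = boundTuple σ wf (c₂ i) α₂

        realized₁ : Realizes σ (c₁ i) (argsS Sig σ) (translate (argsS Sig σ) t₂)
        realized₁ = translate-realized i t₂ refl (boundTuple-realized σ wf (c₂ i) α₂)

        α₁ : Asg D₁ (univQ (qp σ))
        α₁ = proj₁ realized₁

        χ₁ : PAsg Sig D₁
        χ₁ = skolemAsg (c₁ i) α₁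

        sat₁ : Sat Sig R₁ (bindAll ♭ χ₁) φ
        sat₁ = Equivalence.to (sat-applyBP R₁ ♭ χ₁ φ)
                 (satSk-instance R₁ (c₁ i) (applyBP Sig ♭ φ) (R₁⊨F i) α₁)

        atoms : ∀ r → ar r ≡ argsS Sig σ → Sat Sig R₂ (bindAll ♭ χ₂) (rel r) ⇔ Sat Sig R₁ (bindAll ♭ χ₁) (rel r)
        atoms r ar≡A = atom-transfer R₁ r ar≡A t₂ (bindAll ♭ χ₂) (bindAll ♭ χ₁)
          (bindAll-agrees σ wf (c₂ i) χ₂ α₂ t₂ χ₂-from-α₂ (proj₂ (boundTuple-realized σ wf (c₂ i) α₂)))
          (bindAll-agrees σ wf (c₁ i) χ₁ α₁ (translate (argsS Sig σ) t₂)
             (skolemAsg-vars (c₁ i) α₁) (proj₂ realized₁))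

mainTheorem9 : (Sig : Signature) (S : List (Schema Sig)) →
    Unique S → All (WFSchema Sig) S →
    (D₁ D₂ : Set) → D₂ →
    (c₁ : Coupling Sig S D₁) (c₂ : Coupling Sig S D₂) →
    _⪯_ Sig S c₂ c₁ →
    (F : FormulaFn Sig S) →
    Σ[ R₁ ∈ Structure Sig D₁ ] Models Sig S R₁ c₁ F →
    Σ[ R₂ ∈ Structure Sig D₂ ] Models Sig S R₂ c₂ F
mainTheorem9 Sig S _ wfs D₁ D₂ d₂ c₁ c₂ c₂⪯c₁ F (R₁ , R₁⊨F) =
  translated R₁ , translated-models wfs F R₁ R₁⊨F
  where open Transfer Sig S d₂ c₁ c₂ c₂⪯c₁
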